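{- Let $\Gamma_1$ be a trail and let $K$ be a ground literal that is defined in $\Gamma_1$ and is of level $i$ in $\Gamma_1$. Then for every trail of the form $\Gamma := \Gamma_1,\Gamma_2$ (i.e. $\Gamma_1$ extended by a further sequence $\Gamma_2$ of annotated literals), $K$ is of level $i$ in $\Gamma$.
   Context: We work in first-order logic with equality over a signature whose only predicate symbol is equality $\approx$. Literals are equations $s\approx t$ or inequations $s\not\approx t$ ($s\# t$ denotes either); $\mathrm{comp}(L)$ is the complement of $L$. A desired term ordering $\prec_T$ is a well-founded rewrite ordering on terms that is total on ground terms and such that every ground term has only finitely many ground terms $\prec_T$-below it. It is extended to ground literals by assigning the multiset $\{s,t\}$ to $s\approx t$ and $\{s,s,t,t\}$ to $s\not\approx t$ and comparing by the multiset extension of $\prec_T$. For a set/sequence $\Gamma$ of ground literals, $\mathrm{conv}(\Gamma)$ denotes a convergent (terminating and confluent) term rewrite system obtained from the positive equations in $\Gamma$ using $\prec_T$. For a sequence $\Gamma$ of ground literals and a ground literal $L$: $L$ is true in $\Gamma$ if $\Gamma\models L$ (first-order entailment with equality), false in $\Gamma$ if $\Gamma\models\mathrm{comp}(L)$, undefined if neither holds, and defined otherwise. A trail is a sequence $\Gamma=[L_1^{i_1:C_1\cdot\sigma_1},\dots,L_n^{i_n:C_n\cdot\sigma_n}]$ of ground literals that is consistent, where each $L_j$ is annotated with a level $i_j\in\mathbb{N}$ with $i_{j-1}\le i_j$ and a closure $C_j\cdot\sigma_j$ (a clause with a grounding substitution), and such that each $L_j$ is undefined in $[L_1,\dots,L_{j-1}]$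 and irreducible by $\mathrm{conv}(\{L_1,\dots,L_{j-1}\})$. For a trail $\Gamma$ and a ground literal $L$ defined in $\Gamma$, a core of $L$ in $\Gamma$ is a minimal subsequence $\Gamma'\subseteq\Gamma$ such that $L$ is defined in $\Gamma'$; $\mathrm{cores}(\Gamma;L)$ is the set of all cores. The trail ordering $\prec_\Gamma$ is the sequence order: $L_i\prec_\Gamma L_j$ iff $i<j$. A core $\Delta\in\mathrm{cores}(\Gamma;L)$ is a defining core if its $\prec_\Gamma$-maximal literal is $\preceq_\Gamma$ the $\prec_\Gamma$-maximal literal of every core in $\mathrm{cores}(\Gamma;L)$; that maximal literal is the defining literal $\max_\Gamma(L)$ of $L$. If $\mathrm{cores}(\Gamma;L)$ contains only the empty core, $L$ has no defining literal. Levels: a literal $L\in\Gamma$ is of level $i$ if it is annotated with $i$ in $\Gamma$. A defined ground literal $L\notin\Gamma$ is of level $i$ if its defining literal is of level $i$; if $L$ has no defining literal it is of level $0$. -}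

module Defs where

open import Level using (Level; 0ℓ) renaming (suc to lsuc)
open import Data.Nat using (ℕ; zero; suc; _≤_)
open import Data.Fin using (Fin)
import Data.Fin as Fin
open import Data.Fin.Subset using (Subset; _∈_; _⊆_; ⊥; inside; outside)
open import Data.Vec using (Vec; []; _∷_; _[_]≔_; lookup)
open import Data.List using (List; []; _∷_; _∷ʳ_; length; map)
import Data.List as List
open import Data.List.Relation.Unary.All using (All)
import Data.List.Membership.Propositional as LMem
open import Data.Product using (Σ; ∃; _×_; _,_; proj₁; proj₂)
open import Data.Sum using (_⊎_)
open import Data.Empty renaming (⊥ to Empty)
open import Relation.Nullary using (¬_)
open import Relation.Binary.PropositionalEquality using (_≡_)
open import Relation.Binary.Construct.Closure.ReflexiveTransitive using (Star)
open import Relation.Binary.Construct.Closure.Symmetric using (SymClosure)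
open import Induction.WellFounded using (WellFounded)

-- A first-order signature whose only predicate symbol is equality:
-- just function symbols with arities.
record Signature : Set₁ where
  field
    Fun   : Set
    arity : Fun → ℕ

module FO (S : Signature) where
  open Signature S

  data Tm (V : Set) : Set where
    var : V → Tm V
    app : (f : Fun) → Vec (Tm V) (arity f) → Tm V

  GTerm : Set
  GTerm = Tm Empty

  data LitOver (V : Set) : Set where
    _≈_ : Tm V → Tm V → LitOver V
    _≉_ : Tm V → Tm V → LitOver V

  Lit : Set
  Lit = LitOver Empty

  comp : Lit → Lit
  comp (s ≈ t) = s ≉ t
  comp (s ≉ t) = s ≈ t

  Clause : Set
  Clause = List (LitOver ℕ)

  record Closure : Set where
    field
      clause : Clause
      σ      : ℕ → GTerm

  record Model : Set₁ where
    field
      Dom    : Set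
      interp : (f : Fun) → Vec Dom (arity f) → Dom

  module _ (M : Model) where
    open Model M
    mutual
      eval : GTerm → Dom
      eval (var ())
      eval (app f ts) = interp f (evals ts)

      evals : ∀ {n} → Vec GTerm n → Vec Dom n
      evals []       = []
      evals (t ∷ ts) = eval t ∷ evals ts

    _⊧_ : Lit → Set
    _⊧_ (s ≈ t) = eval s ≡ eval t
    _⊧_ (s ≉ t) = ¬ (eval s ≡ eval t)

  _⊧*_ : Model → List Lit → Set
  M ⊧* Γ = All (M ⊧_) Γ

  _⊨_ : List Lit → Lit → Set₁
  Γ ⊨ L = (M : Model) → M ⊧* Γ → M ⊧ L

  Consistent : List Lit → Set₁
  Consistent Γ = Σ Model λ M → M ⊧* Γ

  TrueIn FalseIn Defined Undefined : List Lit → Lit → Set₁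
  TrueIn Γ L = Γ ⊨ L
  FalseIn Γ L = Γ ⊨ comp L
  Defined Γ L = TrueIn Γ L ⊎ FalseIn Γ L
  Undefined Γ L = ¬ Defined Γ L

  record DesiredOrdering : Set₁ where
    field
      _≺_        : GTerm → GTerm → Set
      irrefl     : ∀ {s} → ¬ (s ≺ s)
      trans      : ∀ {s t u} → s ≺ t → t ≺ u → s ≺ u
      wf         : WellFounded _≺_
      total      : ∀ s t → s ≺ t ⊎ (s ≡ t ⊎ t ≺ s)
      monotone   : ∀ f (ts : Vec GTerm (arity f)) (i : Fin (arity f)) s t →
                   s ≺ t → app f (ts [ i ]≔ s) ≺ app f (ts [ i ]≔ t)
      finBelow   : ∀ t → Σ (List GTerm) λ xs → ∀ s → s ≺ t → s LMem.∈ xs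

  TRS : Set
  TRS = List (GTerm × GTerm)

  data _⟶[_]_ : GTerm → TRS → GTerm → Set where
    root : ∀ {R l r} → (l , r) LMem.∈ R → l ⟶[ R ] r
    cong : ∀ {R f} (ts : Vec GTerm (arity f)) (i : Fin (arity f)) {u} →
           lookup ts i ⟶[ R ] u → app f ts ⟶[ R ] app f (ts [ i ]≔ u)

  Step : TRS → GTerm → GTerm → Set
  Step R s t = s ⟶[ R ] t

  Terminating : TRS → Set
  Terminating R = WellFounded (λ t s → s ⟶[ R ] t)

  Confluent : TRS → Set
  Confluent R = ∀ {s t u} → Star (Step R) s t → Star (Step R) s u →
                Σ GTerm λ v → Star (Step R) t v × Star (Step R) u v

  Convertible : TRS → GTerm → GTerm → Set
  Convertible R = Star (SymClosure (Step R))

  posEqs : List Lit → List Lit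
  posEqs [] = []
  posEqs ((s ≈ t) ∷ Γ) = (s ≈ t) ∷ posEqs Γ
  posEqs ((s ≉ t) ∷ Γ) = posEqs Γ

  IsConv : DesiredOrdering → List Lit → TRS → Set₁
  IsConv O Γ R =
    Terminating R × Confluent R ×
    (∀ {l r} → (l , r) LMem.∈ R → DesiredOrdering._≺_ O r l) ×
    (∀ s t → (Convertible R s t → posEqs Γ ⊨ (s ≈ t)) ×
             (posEqs Γ ⊨ (s ≈ t) → Convertible R s t))

  IrreducibleTerm : TRS → GTerm → Set
  IrreducibleTerm R s = ∀ u → ¬ (s ⟶[ R ] u)

  IrreducibleLit : TRS → Lit → Set
  IrreducibleLit R (s ≈ t) = IrreducibleTerm R s × IrreducibleTerm R t
  IrreducibleLit R (s ≉ t) = IrreducibleTerm R s × IrreducibleTerm R t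

  IrreducibleByConv : DesiredOrdering → List Lit → Lit → Set₁
  IrreducibleByConv O Γ L = ∀ R → IsConv O Γ R → IrreducibleLit R L

  record ALit : Set where
    constructor annot
    field
      lit     : Lit
      level   : ℕ
      closure : Closure
  open ALit public

  lits : List ALit → List Lit
  lits = map lit

  data IsTrailSeq (O : DesiredOrdering) : List ALit → Set₁ where
    []  : IsTrailSeq O []
    snoc : ∀ {Γ} (a : ALit) → IsTrailSeq O Γ →
           All (λ b → level b ≤ level a) Γ →
           Undefined (lits Γ) (lit a) →
           IrreducibleByConv O (lits Γ) (lit a) →
           IsTrailSeq O (Γ ∷ʳ a)

  IsTrail : DesiredOrdering → List ALit → Set₁
  IsTrail O Γ = IsTrailSeq O Γ × Consistent (lits Γ)

  select : (Γ : List ALit) → Subset (length Γ) → List Lit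
  select [] [] = []
  select (a ∷ Γ) (inside ∷ S)  = lit a ∷ select Γ S
  select (a ∷ Γ) (outside ∷ S) = select Γ S

  IsCore : (Γ : List ALit) → Lit → Subset (length Γ) → Set₁
  IsCore Γ L S = Defined (select Γ S) L ×
                 (∀ S' → S' ⊆ S → Defined (select Γ S') L → S' ≡ S)

  IsMaxPos : ∀ {n} → Subset n → Fin n → Set
  IsMaxPos S j = j ∈ S × (∀ k → k ∈ S → k Fin.≤ j)

  IsDefiningPos : (Γ : List ALit) → Lit → Fin (length Γ) → Set₁
  IsDefiningPos Γ L j =
    Σ (Subset (length Γ)) λ S → IsCore Γ L S × IsMaxPos S j ×
      (∀ S' k → IsCore Γ L S' → IsMaxPos S' k → j Fin.≤ k)

  data LevelOf (Γ : List ALit) (L : Lit) (i : ℕ) : Set₁ where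
    inTrail  : (p : Fin (length Γ)) → lit (List.lookup Γ p) ≡ L →
               level (List.lookup Γ p) ≡ i → LevelOf Γ L i
    viaDef   : ¬ (L LMem.∈ lits Γ) → Defined (lits Γ) L →
               (j : Fin (length Γ)) → IsDefiningPos Γ L j →
               level (List.lookup Γ j) ≡ i → LevelOf Γ L i
    noDef    : ¬ (L LMem.∈ lits Γ) → Defined (lits Γ) L →
               IsCore Γ L ⊥ → i ≡ 0 → LevelOf Γ L i

-- A literal of Γ₁ keeps its position, and so its level, in Γ₁ , Γ₂. A literal K ∉ Γ₁ that
-- is defined in Γ₁ cannot occur in Γ₂, since every literal of a trail is undefined in its
-- prefix. The cores of K in Γ₁ , Γ₂ that lie inside Γ₁ are exactly the cores of K in Γ₁,
-- and every other core has its maximal literal in Γ₂, hence above all of Γ₁; so the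
-- defining literal of K (and the empty core, if it is one) is the same in both trails.
module Submission where

open import Defs
open import Data.Nat using (ℕ; suc; z≤n; s≤s)
open import Data.Nat.Properties using (<⇒≤; <⇒≱)
open import Data.List using (List; []; _∷_; _++_; [_]; length; InitLast; initLast)
import Data.List as List
open import Data.List.Properties using (map-++; ++-assoc; ∷ʳ-injective; ∷ʳ-injectiveˡ)
open import Data.List.Membership.Propositional using () renaming (_∈_ to _∈ᴸ_)
open import Data.List.Membership.Propositional.Properties using (∈-map⁺; ∈-map⁻; ∈-++⁻; ∈-∃++)
import Data.List.Relation.Unary.All.Properties as All
open import Data.Fin using (Fin; zero; suc; toℕ) renaming (_≤_ to _≤ᶠ_; _<_ to _<ᶠ_)
open import Data.Fin.Subset using (Subset; _∈_; _⊆_; ⊥; inside; outside)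
open import Data.Fin.Subset.Properties using (Empty-unique; ∉⊥)
open import Data.Vec using ([]; _∷_; here; there)
open import Data.Product using (∃; _×_; _,_)
open import Data.Sum using (_⊎_; inj₁; inj₂)
open import Data.Empty using (⊥-elim)
open import Relation.Nullary using (¬_)
open import Relation.Binary.PropositionalEquality
  using (_≡_; refl; sym; trans; cong; subst)

module _ {A : Set} where

  embed : (xs ys : List A) → Fin (length xs) → Fin (length (xs ++ ys))
  embed (x ∷ xs) ys zero    = zero
  embed (x ∷ xs) ys (suc k) = suc (embed xs ys k)

  Embedded : (xs ys : List A) → Fin (length (xs ++ ys)) → Set
  Embedded xs ys k = ∃ λ k₀ → k ≡ embed xs ys k₀

  toℕ-embed : ∀ xs ys k → toℕ (embed xs ys k) ≡ toℕ k
  toℕ-embed (x ∷ xs) ys zero    = refl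
  toℕ-embed (x ∷ xs) ys (suc k) = cong suc (toℕ-embed xs ys k)

  lookup-embed : ∀ xs ys k → List.lookup (xs ++ ys) (embed xs ys k) ≡ List.lookup xs k
  lookup-embed (x ∷ xs) ys zero    = refl
  lookup-embed (x ∷ xs) ys (suc k) = lookup-embed xs ys k

  embed-mono-≤ : ∀ xs ys {a b} → a ≤ᶠ b → embed xs ys a ≤ᶠ embed xs ys b
  embed-mono-≤ xs ys {a} {b} a≤b
    rewrite toℕ-embed xs ys a | toℕ-embed xs ys b = a≤b

  embed-cancel-≤ : ∀ xs ys {a b} → embed xs ys a ≤ᶠ embed xs ys b → a ≤ᶠ b
  embed-cancel-≤ xs ys {a} {b} a≤b
    rewrite toℕ-embed xs ys a | toℕ-embed xs ys b = a≤b

  embedded-or-above : ∀ xs ys k → Embedded xs ys k ⊎ (∀ k₀ → embed xs ys k₀ <ᶠ k)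
  embedded-or-above []       ys k       = inj₂ λ ()
  embedded-or-above (x ∷ xs) ys zero    = inj₁ (zero , refl)
  embedded-or-above (x ∷ xs) ys (suc k) with embedded-or-above xs ys k
  ... | inj₁ (k₀ , refl) = inj₁ (suc k₀ , refl)
  ... | inj₂ above       = inj₂ λ { zero → s≤s z≤n ; (suc k₀) → s≤s (above k₀) }

  pad : (xs ys : List A) → Subset (length xs) → Subset (length (xs ++ ys))
  pad []       ys []      = ⊥
  pad (x ∷ xs) ys (b ∷ S) = b ∷ pad xs ys S

  trim : (xs ys : List A) → Subset (length (xs ++ ys)) → Subset (length xs)
  trim []       ys T       = []
  trim (x ∷ xs) ys (b ∷ T) = b ∷ trim xs ys T

  trim-pad : ∀ xs ys S → trim xs ys (pad xs ys S) ≡ S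
  trim-pad []       ys []      = refl
  trim-pad (x ∷ xs) ys (b ∷ S) = cong (b ∷_) (trim-pad xs ys S)

  pad-⊥ : ∀ xs ys → pad xs ys ⊥ ≡ ⊥
  pad-⊥ []       ys = refl
  pad-⊥ (x ∷ xs) ys = cong (outside ∷_) (pad-⊥ xs ys)

  InPrefix : (xs ys : List A) → Subset (length (xs ++ ys)) → Set
  InPrefix xs ys T = pad xs ys (trim xs ys T) ≡ T

  embedded⇒InPrefix : ∀ xs ys T → (∀ {k} → k ∈ T → Embedded xs ys k) → InPrefix xs ys T
  embedded⇒InPrefix []       ys T       embedded =
    sym (Empty-unique λ { (k , k∈T) → absurd (embedded k∈T) })
    where absurd : ∀ {k} → ¬ Embedded [] ys k
          absurd (() , _)
  embedded⇒InPrefix (x ∷ xs) ys (b ∷ T) embedded =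
    cong (b ∷_) (embedded⇒InPrefix xs ys T λ k∈T → predecessor (embedded (there k∈T)))
    where predecessor : ∀ {k} → Embedded (x ∷ xs) ys (suc k) → Embedded xs ys k
          predecessor (suc k₀ , refl) = k₀ , refl

  ∈-pad⁺ : ∀ xs ys S {k} → k ∈ S → embed xs ys k ∈ pad xs ys S
  ∈-pad⁺ (x ∷ xs) ys (b ∷ S) here        = here
  ∈-pad⁺ (x ∷ xs) ys (b ∷ S) (there k∈S) = there (∈-pad⁺ xs ys S k∈S)

  ∈-pad⁻ : ∀ xs ys S {k} → embed xs ys k ∈ pad xs ys S → k ∈ S
  ∈-pad⁻ (x ∷ xs) ys (b ∷ S) {zero}  here        = here
  ∈-pad⁻ (x ∷ xs) ys (b ∷ S) {suc k} (there k∈S) = there (∈-pad⁻ xs ys S k∈S)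

  ∈-pad⇒Embedded : ∀ xs ys S {k} → k ∈ pad xs ys S → Embedded xs ys k
  ∈-pad⇒Embedded []       ys []      k∈⊥ = ⊥-elim (∉⊥ k∈⊥)
  ∈-pad⇒Embedded (x ∷ xs) ys (b ∷ S) here = zero , refl
  ∈-pad⇒Embedded (x ∷ xs) ys (b ∷ S) (there k∈S) with ∈-pad⇒Embedded xs ys S k∈S
  ... | k₀ , refl = suc k₀ , refl

  ∈-trim⁺ : ∀ xs ys T {k} → embed xs ys k ∈ T → k ∈ trim xs ys T
  ∈-trim⁺ (x ∷ xs) ys (b ∷ T) {zero}  here        = here
  ∈-trim⁺ (x ∷ xs) ys (b ∷ T) {suc k} (there k∈T) = there (∈-trim⁺ xs ys T k∈T)

  ∈-trim⁻ : ∀ xs ys T {k} → k ∈ trim xs ys T → embed xs ys k ∈ T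
  ∈-trim⁻ (x ∷ xs) ys (b ∷ T) here        = here
  ∈-trim⁻ (x ∷ xs) ys (b ∷ T) (there k∈T) = there (∈-trim⁻ xs ys T k∈T)

  pad-mono : ∀ xs ys {S S'} → S ⊆ S' → pad xs ys S ⊆ pad xs ys S'
  pad-mono xs ys {S} {S'} S⊆S' k∈S with ∈-pad⇒Embedded xs ys S k∈S
  ... | k₀ , refl = ∈-pad⁺ xs ys S' (S⊆S' (∈-pad⁻ xs ys S k∈S))

  ⊆-pad⇒InPrefix : ∀ xs ys S {T} → T ⊆ pad xs ys S → InPrefix xs ys T
  ⊆-pad⇒InPrefix xs ys S {T} T⊆S =
    embedded⇒InPrefix xs ys T λ k∈T → ∈-pad⇒Embedded xs ys S (T⊆S k∈T)

  trim-⊆ : ∀ xs ys S {T} → T ⊆ pad xs ys S → trim xs ys T ⊆ S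
  trim-⊆ xs ys S {T} T⊆S k∈T = ∈-pad⁻ xs ys S (T⊆S (∈-trim⁻ xs ys T k∈T))

module _ (Sig : Signature) where
  open FO Sig hiding (cong)

  defined-++ : ∀ Γ Δ {L} → Defined Γ L → Defined (Γ ++ Δ) L
  defined-++ Γ Δ (inj₁ true)  = inj₁ λ M M⊧ → true M (All.++⁻ˡ Γ M⊧)
  defined-++ Γ Δ (inj₂ false) = inj₂ λ M M⊧ → false M (All.++⁻ˡ Γ M⊧)

  defined-lits-++ : ∀ Γ₁ Γ₂ {L} → Defined (lits Γ₁) L → Defined (lits (Γ₁ ++ Γ₂)) L
  defined-lits-++ Γ₁ Γ₂ {L} d =
    subst (λ Γ → Defined Γ L) (sym (map-++ lit Γ₁ Γ₂)) (defined-++ (lits Γ₁) (lits Γ₂) d)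

  undefined-before : ∀ {O Γ} → IsTrailSeq O Γ →
                     ∀ P a R → P ++ a ∷ R ≡ Γ → Undefined (lits P) (lit a)
  undefined-before [] []      _ _ ()
  undefined-before [] (_ ∷ _) _ _ ()
  undefined-before (snoc {Γ} b trail _ undefined _) P a R eq with initLast R
  ... | [] with refl , refl ← ∷ʳ-injective P Γ eq = undefined
  ... | R' InitLast.∷ʳ′ c =
    undefined-before trail P a R'
      (∷ʳ-injectiveˡ (P ++ a ∷ R') Γ (trans (++-assoc P (a ∷ R') [ c ]) eq))

  ∉-extension : ∀ {O} Γ₁ Γ₂ {K} → IsTrailSeq O (Γ₁ ++ Γ₂) → Defined (lits Γ₁) K →
                ¬ (K ∈ᴸ lits Γ₁) → ¬ (K ∈ᴸ lits (Γ₁ ++ Γ₂))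
  ∉-extension Γ₁ Γ₂ trail d K∉Γ₁ K∈Γ with ∈-map⁻ lit K∈Γ
  ... | a , a∈Γ , refl with ∈-++⁻ Γ₁ a∈Γ
  ... | inj₁ a∈Γ₁ = K∉Γ₁ (∈-map⁺ lit a∈Γ₁)
  ... | inj₂ a∈Γ₂ with ∈-∃++ a∈Γ₂
  ... | Q , R , refl =
    undefined-before trail (Γ₁ ++ Q) a R (++-assoc Γ₁ Q (a ∷ R)) (defined-lits-++ Γ₁ Q d)

  select-⊥ : ∀ Γ → select Γ ⊥ ≡ []
  select-⊥ []      = refl
  select-⊥ (_ ∷ Γ) = select-⊥ Γ

  select-pad : ∀ Γ₁ Γ₂ S → select (Γ₁ ++ Γ₂) (pad Γ₁ Γ₂ S) ≡ select Γ₁ S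
  select-pad []       Γ₂ []            = select-⊥ Γ₂
  select-pad (a ∷ Γ₁) Γ₂ (inside ∷ S)  = cong (lit a ∷_) (select-pad Γ₁ Γ₂ S)
  select-pad (a ∷ Γ₁) Γ₂ (outside ∷ S) = select-pad Γ₁ Γ₂ S

  module _ (Γ₁ Γ₂ : List ALit) where

    IsMaxPos-pad : ∀ {S j} → IsMaxPos S j → IsMaxPos (pad Γ₁ Γ₂ S) (embed Γ₁ Γ₂ j)
    IsMaxPos-pad {S} (j∈S , maximal) = ∈-pad⁺ Γ₁ Γ₂ S j∈S , λ k k∈S → below k k∈S
      where below : ∀ k → k ∈ pad Γ₁ Γ₂ S → k ≤ᶠ embed Γ₁ Γ₂ _
            below k k∈S with ∈-pad⇒Embedded Γ₁ Γ₂ S k∈S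
            ... | k₀ , refl = embed-mono-≤ Γ₁ Γ₂ (maximal k₀ (∈-pad⁻ Γ₁ Γ₂ S k∈S))

    IsMaxPos-embedded : ∀ {T k} → IsMaxPos T (embed Γ₁ Γ₂ k) →
                        InPrefix Γ₁ Γ₂ T × IsMaxPos (trim Γ₁ Γ₂ T) k
    IsMaxPos-embedded {T} {k} (k∈T , maximal) =
      embedded⇒InPrefix Γ₁ Γ₂ T embedded ,
      ∈-trim⁺ Γ₁ Γ₂ T k∈T ,
      λ k' k'∈T → embed-cancel-≤ Γ₁ Γ₂ (maximal _ (∈-trim⁻ Γ₁ Γ₂ T k'∈T))
      where embedded : ∀ {k'} → k' ∈ T → Embedded Γ₁ Γ₂ k'
            embedded {k'} k'∈T with embedded-or-above Γ₁ Γ₂ k'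
            ... | inj₁ e     = e
            ... | inj₂ above = ⊥-elim (<⇒≱ (above k) (maximal k' k'∈T))

  module _ (Γ₁ Γ₂ : List ALit) (K : Lit) where

    defined-select-pad : ∀ {S} → Defined (select Γ₁ S) K →
                         Defined (select (Γ₁ ++ Γ₂) (pad Γ₁ Γ₂ S)) K
    defined-select-pad {S} = subst (λ Δ → Defined Δ K) (sym (select-pad Γ₁ Γ₂ S))

    defined-select-trim : ∀ {T} → InPrefix Γ₁ Γ₂ T →
                          Defined (select (Γ₁ ++ Γ₂) T) K → Defined (select Γ₁ (trim Γ₁ Γ₂ T)) K
    defined-select-trim {T} T⊆Γ₁ =
      subst (λ Δ → Defined Δ K) (trans (cong (select (Γ₁ ++ Γ₂)) (sym T⊆Γ₁)) (select-pad Γ₁ Γ₂ _))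

    IsCore-pad : ∀ {S} → IsCore Γ₁ K S → IsCore (Γ₁ ++ Γ₂) K (pad Γ₁ Γ₂ S)
    IsCore-pad {S} (d , minimal) = defined-select-pad d , λ T T⊆S dT →
      let T⊆Γ₁ = ⊆-pad⇒InPrefix Γ₁ Γ₂ S T⊆S
      in trans (sym T⊆Γ₁) (cong (pad Γ₁ Γ₂)
           (minimal (trim Γ₁ Γ₂ T) (trim-⊆ Γ₁ Γ₂ S T⊆S) (defined-select-trim T⊆Γ₁ dT)))

    IsCore-trim : ∀ {T} → InPrefix Γ₁ Γ₂ T →
                  IsCore (Γ₁ ++ Γ₂) K T → IsCore Γ₁ K (trim Γ₁ Γ₂ T)
    IsCore-trim {T} T⊆Γ₁ (d , minimal) = defined-select-trim T⊆Γ₁ d , λ S S⊆ dS →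
      let padS⊆T = subst (pad Γ₁ Γ₂ S ⊆_) T⊆Γ₁ (pad-mono Γ₁ Γ₂ S⊆)
      in trans (sym (trim-pad Γ₁ Γ₂ S))
           (cong (trim Γ₁ Γ₂) (minimal (pad Γ₁ Γ₂ S) padS⊆T (defined-select-pad dS)))

    IsDefiningPos-embed : ∀ {j} → IsDefiningPos Γ₁ K j →
                          IsDefiningPos (Γ₁ ++ Γ₂) K (embed Γ₁ Γ₂ j)
    IsDefiningPos-embed {j} (S , core , max , least) =
      pad Γ₁ Γ₂ S , IsCore-pad core , IsMaxPos-pad Γ₁ Γ₂ max , least′
      where
      least′ : ∀ T k → IsCore (Γ₁ ++ Γ₂) K T → IsMaxPos T k → embed Γ₁ Γ₂ j ≤ᶠ k
      least′ T k coreT maxT with embedded-or-above Γ₁ Γ₂ k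
      ... | inj₂ above        = <⇒≤ (above j)
      ... | inj₁ (k₀ , refl) with IsMaxPos-embedded Γ₁ Γ₂ maxT
      ... | T⊆Γ₁ , maxTrim = embed-mono-≤ Γ₁ Γ₂ (least _ k₀ (IsCore-trim T⊆Γ₁ coreT) maxTrim)

lemma1 : (S : Signature) → let open FO S in
    (O : DesiredOrdering) (Γ₁ : List ALit) (K : Lit) (i : ℕ) →
    IsTrail O Γ₁ → Defined (lits Γ₁) K → LevelOf Γ₁ K i →
    (Γ₂ : List ALit) → IsTrail O (Γ₁ ++ Γ₂) →
    LevelOf (Γ₁ ++ Γ₂) K i
lemma1 Sig O Γ₁ K i _ d level-i Γ₂ (trail , _) = extend level-i
  where
  open FO Sig hiding (cong)
  K∉Γ : ¬ (K ∈ᴸ lits Γ₁) → ¬ (K ∈ᴸ lits (Γ₁ ++ Γ₂))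
  K∉Γ = ∉-extension Sig Γ₁ Γ₂ trail d
  dΓ : Defined (lits (Γ₁ ++ Γ₂)) K
  dΓ = defined-lits-++ Sig Γ₁ Γ₂ d
  extend : LevelOf Γ₁ K i → LevelOf (Γ₁ ++ Γ₂) K i
  extend (inTrail p lit≡ level≡) =
    inTrail (embed Γ₁ Γ₂ p) (trans (cong lit (lookup-embed Γ₁ Γ₂ p)) lit≡)
                            (trans (cong level (lookup-embed Γ₁ Γ₂ p)) level≡)
  extend (viaDef K∉ _ j defining level≡) =
    viaDef (K∉Γ K∉) dΓ (embed Γ₁ Γ₂ j) (IsDefiningPos-embed Sig Γ₁ Γ₂ K defining)
           (trans (cong level (lookup-embed Γ₁ Γ₂ j)) level≡)
  extend (noDef K∉ _ core i≡0) =
    noDef (K∉Γ K∉) dΓ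
          (subst (IsCore (Γ₁ ++ Γ₂) K) (pad-⊥ Γ₁ Γ₂) (IsCore-pad Sig Γ₁ Γ₂ K core)) i≡0
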